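{- For each integer $k\geq 4$, every $k$-chordal graph is $\frac{\lfloor k/2\rfloor}{2}$-hyperbolic.
   Context: All graphs are simple, unweighted, connected, but not necessarily finite; $d=d_G$ denotes the shortest-path metric and $xy$ abbreviates $d(x,y)$. For vertices $x,y,u,v$, $\delta(x,y,u,v)$ is the difference between the largest and the second largest of the three numbers $\frac{uv+xy}{2}$, $\frac{ux+vy}{2}$, $\frac{uy+vx}{2}$. $G$ is $\delta$-hyperbolic if $\delta(x,y,u,v)\leq\delta$ for all vertices $x,y,u,v$. A graph is $k$-chordal if it contains no induced (chordless) cycle of length greater than $k$. -}

module Defs where

open import Level using (Level; _⊔_)
open import Data.Nat as ℕ using (ℕ; zero; suc; _+_; _≤_; _<_; ⌊_/2⌋)
open import Data.Fin using (Fin; toℕ)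
open import Data.Integer using (+_)
open import Data.Rational as ℚ using (ℚ)
open import Data.Product using (Σ; ∃; _×_; _,_)
open import Data.Sum using (_⊎_)
open import Relation.Nullary using (¬_)
open import Relation.Binary.PropositionalEquality using (_≡_)
open import Function.Definitions using (Injective)
open import Function.Bundles using (_⇔_)

record Graph (a b : Level) : Set (Level.suc (a ⊔ b)) where
  field
    V     : Set a
    E     : V → V → Set b
    sym   : ∀ {x y} → E x y → E y x
    irrefl : ∀ {x} → ¬ E x x

module _ {a b} (G : Graph a b) where
  open Graph G

  data Walk : V → V → ℕ → Set (a ⊔ b) where
    here : ∀ {x} → Walk x x zero
    step : ∀ {x y z n} → E x y → Walk y z n → Walk x z (suc n)

  Connected : Set (a ⊔ b)
  Connected = ∀ x y → ∃ λ n → Walk x y n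

  Dist : V → V → ℕ → Set (a ⊔ b)
  Dist x y n = Walk x y n × (∀ m → Walk x y m → n ≤ m)

  CycAdj : ∀ {m} → Fin m → Fin m → Set
  CycAdj {m} i j =
      suc (toℕ i) ≡ toℕ j ⊎ suc (toℕ j) ≡ toℕ i
    ⊎ (toℕ i ≡ 0 × suc (toℕ j) ≡ m) ⊎ (toℕ j ≡ 0 × suc (toℕ i) ≡ m)

  InducedCycle : ℕ → Set (a ⊔ b)
  InducedCycle m = 3 ≤ m × Σ (Fin m → V) λ c →
    Injective _≡_ _≡_ c × (∀ i j → E (c i) (c j) ⇔ CycAdj i j)

  Chordal : ℕ → Set (a ⊔ b)
  Chordal k = ∀ m → k < m → ¬ InducedCycle m

half : ℕ → ℚ
half n = (+ n) ℚ./ 2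

max3 med3 : ℚ → ℚ → ℚ → ℚ
max3 p q r = p ℚ.⊔ q ℚ.⊔ r
-- second largest of three numbers (the median)
med3 p q r = (p ℚ.⊓ q) ℚ.⊔ (q ℚ.⊓ r) ℚ.⊔ (p ℚ.⊓ r)

δ₄ : (uv xy ux vy uy vx : ℕ) → ℚ
δ₄ uv xy ux vy uy vx =
  let s₁ = half (uv + xy) ; s₂ = half (ux + vy) ; s₃ = half (uy + vx)
  in max3 s₁ s₂ s₃ ℚ.- med3 s₁ s₂ s₃

module _ {a b} (G : Graph a b) where
  open Graph G

  Hyperbolic : ℚ → Set (a ⊔ b)
  Hyperbolic δ = ∀ x y u v (uv xy ux vy uy vx : ℕ) →
    Dist G u v uv → Dist G x y xy → Dist G u x ux →
    Dist G v y vy → Dist G u y uy → Dist G v x vx →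
    δ₄ uv xy ux vy uy vx ℚ.≤ δ

-- Four geodesics u → x → v → y → u close up to a quadrangle: a closed walk with corners U, X, V, Y
-- (single vertices or edges) joined by sides A, B, C, D.  If G has no induced cycle longer than
-- 2K + 1, where K ≥ 2, then every quadrangle satisfies
--   d(U, V) + d(X, Y) ≤ max(|A| + |C|, |B| + |D|) + K,
-- by induction on its length.  Walking around a quadrangle of length at most 2K + 1 bounds each
-- diagonal by two complementary arcs.  A longer closed walk is not an induced cycle, so it has a
-- chord or repeats a vertex.  A chord between opposite sides bounds both diagonals directly (this
-- is where K ≥ 2 is needed); any other chord, rotated to start on A, cuts off a shorter
-- quadrangle in which only the corner X moves, onto the chord, while the sides shrink by at least
-- the distance it moved.  With K = ⌊k/2⌋ and the three pairings of u, x, v, y, the largest of the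
-- three pair sums exceeds the median by at most K, which is δ ≤ K/2 after halving.

module Submission where

open import Defs
import Level
open import Level using (Level)
open import Data.Nat using (ℕ; zero; suc; _+_; _*_; _∸_; _⊔_; _⊓_; _≤_; _<_; z≤n; s≤s; z<s; _≤?_; _≟_; ⌊_/2⌋)
open import Data.Nat.Properties
open import Data.Nat.Tactic.RingSolver using (solve)
open import Data.List using (_∷_; [])
open import Data.Fin using (Fin; toℕ)
open import Data.Fin.Properties using (toℕ-injective; toℕ<n)
open import Data.Product using (Σ; _×_; _,_)
open import Data.Sum using (inj₁; inj₂)
open import Data.Empty using (⊥; ⊥-elim)
open import Data.Integer as ℤ using (+≤+)
import Data.Integer.Properties as ℤ
open import Data.Rational as ℚ using (0ℚ; toℚᵘ)
import Data.Rational.Properties as ℚ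
open import Data.Rational.Unnormalised as ℚᵘ using (mkℚᵘ; *≤*; *≡*)
import Data.Rational.Unnormalised.Properties as ℚᵘ
open import Relation.Nullary using (¬_; Dec; yes; no)
open import Relation.Nullary.Decidable using (_⊎-dec_; _×-dec_)
open import Relation.Binary using (tri<; tri≈; tri>)
open import Relation.Binary.PropositionalEquality
open import Function.Base using (_∘_)
open import Function.Bundles using (mk⇔)
open import Algebra.Properties.CommutativeSemigroup +-commutativeSemigroup using (x∙yz≈xz∙y; xy∙z≈xz∙y)

module WalkCalculus {a b : Level} (G : Graph a b) where
  open Graph G renaming (sym to E-sym)

  infixl 5 _++ʷ_

  _++ʷ_ : ∀ {x y z n m} → Walk G x y n → Walk G y z m → Walk G x z (n + m)
  here ++ʷ q = q
  step e p ++ʷ q = step e (p ++ʷ q)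

  snocʷ : ∀ {x y z n} → Walk G x y n → E y z → Walk G x z (suc n)
  snocʷ here e = step e here
  snocʷ (step e′ p) e = step e′ (snocʷ p e)

  reverseʷ : ∀ {x y n} → Walk G x y n → Walk G y x n
  reverseʷ here = here
  reverseʷ (step e p) = snocʷ (reverseʷ p) (E-sym e)

  castʷ : ∀ {x x′ y y′ n} → x ≡ x′ → y ≡ y′ → Walk G x y n → Walk G x′ y′ n
  castʷ refl refl p = p

  data Hop : ℕ → V → V → Set (a Level.⊔ b) where
    stay : ∀ {x y} → x ≡ y → Hop 0 x y
    move : ∀ {x y} → E x y → Hop 1 x y

  hop⇒walk : ∀ {e x y} → Hop e x y → Walk G x y e
  hop⇒walk (stay refl) = here
  hop⇒walk (move h) = step h here

  hop-sym : ∀ {e x y} → Hop e x y → Hop e y x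
  hop-sym (stay eq) = stay (sym eq)
  hop-sym (move h) = move (E-sym h)

  hop-cast : ∀ {e x x′ y y′} → x ≡ x′ → y ≡ y′ → Hop e x y → Hop e x′ y′
  hop-cast refl refl h = h

  hop≤1 : ∀ {e x y} → Hop e x y → e ≤ 1
  hop≤1 (stay _) = z≤n
  hop≤1 (move _) = s≤s z≤n

  record ClosedWalk (L : ℕ) : Set (a Level.⊔ b) where
    field
      at : ℕ → V
      adj : ∀ i → i < L → E (at i) (at (suc i))
      closed : at L ≡ at 0

    segment : ∀ i m j → i + m ≡ j → j ≤ L → Walk G (at i) (at j) m
    segment i zero j i+0≡j _ = castʷ refl (cong at (trans (sym (+-identityʳ i)) i+0≡j)) here
    segment i (suc m) j i+1+m≡j j≤L =
      step (adj i (≤-trans (s≤s (m≤m+n i m)) (≤-trans (≤-reflexive 1+i+m≡j) j≤L)))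
           (segment (suc i) m j 1+i+m≡j j≤L)
      where
        1+i+m≡j : suc i + m ≡ j
        1+i+m≡j = trans (sym (+-suc i m)) i+1+m≡j

  -- Positions i < j whose vertices are equal or adjacent although they are
  -- not consecutive on the closed walk, neither directly nor across position L ≡ 0.
  record Chord {L : ℕ} (w : ClosedWalk L) : Set (a Level.⊔ b) where
    open ClosedWalk w
    field
      i j e : ℕ
      hop : Hop e (at i) (at j)
      gap : i + suc e ≤ j
      gap-around : j + suc e ≤ L + i
      j≤L : j ≤ L

  cycAdj? : ∀ {m} (i j : Fin m) → Dec (CycAdj G i j)
  cycAdj? {m} i j =
    (suc (toℕ i) ≟ toℕ j) ⊎-dec ((suc (toℕ j) ≟ toℕ i) ⊎-dec
      (((toℕ i ≟ 0) ×-dec (suc (toℕ j) ≟ m)) ⊎-dec ((toℕ j ≟ 0) ×-dec (suc (toℕ i) ≟ m))))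

  chordless⇒induced : ∀ {L} (w : ClosedWalk L) → 3 ≤ L → ¬ Chord w → InducedCycle G L
  chordless⇒induced {L} w 3≤L chordless = 3≤L , cycle , injective , λ x y → mk⇔ (E⇒CycAdj x y) (CycAdj⇒E x y)
    where
      open ClosedWalk w
      cycle : Fin L → V
      cycle x = at (toℕ x)

      no-repeat : ∀ {x y} → x < y → y < L → at x ≢ at y
      no-repeat {x} {y} x<y y<L eq = chordless record
        { i = x ; j = y ; e = 0 ; hop = stay eq
        ; gap = ≤-trans (≤-reflexive (+-comm x 1)) x<y
        ; gap-around = ≤-trans (≤-reflexive (+-comm y 1)) (≤-trans y<L (m≤m+n L x))
        ; j≤L = <⇒≤ y<L }

      injective : ∀ {x y} → cycle x ≡ cycle y → x ≡ y
      injective {x} {y} eq with <-cmp (toℕ x) (toℕ y)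
      ... | tri≈ _ x≡y _ = toℕ-injective x≡y
      ... | tri< x<y _ _ = ⊥-elim (no-repeat x<y (toℕ<n y) eq)
      ... | tri> _ _ y<x = ⊥-elim (no-repeat y<x (toℕ<n x) (sym eq))

      no-shortcut : ∀ x y → x < y → y < L → E (at x) (at y) → suc x ≢ y → ¬ (x ≡ 0 × suc y ≡ L) → ⊥
      no-shortcut x y x<y y<L xy 1+x≢y not-around = chordless record
        { i = x ; j = y ; e = 1 ; hop = move xy
        ; gap = ≤-trans (≤-reflexive (+-comm x 2)) (≤∧≢⇒< x<y 1+x≢y)
        ; gap-around = ≤-trans (≤-reflexive (+-comm y 2)) (around x not-around)
        ; j≤L = <⇒≤ y<L }
        where
          around : ∀ x → ¬ (x ≡ 0 × suc y ≡ L) → suc (suc y) ≤ L + x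
          around zero not-around =
            ≤-trans (≤∧≢⇒< y<L (λ 1+y≡L → not-around (refl , 1+y≡L))) (≤-reflexive (sym (+-identityʳ L)))
          around (suc x) _ = ≤-trans (s≤s y<L) (≤-trans (≤-reflexive (+-comm 1 L)) (+-monoʳ-≤ L (s≤s z≤n)))

      E⇒CycAdj : ∀ x y → E (cycle x) (cycle y) → CycAdj G x y
      E⇒CycAdj x y xy with cycAdj? x y
      ... | yes adjacent = adjacent
      ... | no ¬adjacent with <-cmp (toℕ x) (toℕ y)
      ...   | tri≈ _ x≡y _ = ⊥-elim (irrefl (subst (λ z → E (cycle x) (at z)) (sym x≡y) xy))
      ...   | tri< x<y _ _ = ⊥-elim (no-shortcut (toℕ x) (toℕ y) x<y (toℕ<n y) xy
                               (λ eq → ¬adjacent (inj₁ eq)) (λ eq → ¬adjacent (inj₂ (inj₂ (inj₁ eq)))))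
      ...   | tri> _ _ y<x = ⊥-elim (no-shortcut (toℕ y) (toℕ x) y<x (toℕ<n x) (E-sym xy)
                               (λ eq → ¬adjacent (inj₂ (inj₁ eq))) (λ eq → ¬adjacent (inj₂ (inj₂ (inj₂ eq)))))

      wrap : ∀ {x y} → toℕ x ≡ 0 → suc (toℕ y) ≡ L → E (cycle y) (cycle x)
      wrap {x} {y} x≡0 1+y≡L =
        subst (E (cycle y)) (trans (cong at 1+y≡L) (trans closed (cong at (sym x≡0)))) (adj (toℕ y) (≤-reflexive 1+y≡L))

      forward : ∀ {x y} → suc (toℕ x) ≡ toℕ y → E (cycle x) (cycle y)
      forward {x} {y} 1+x≡y = subst (λ z → E (cycle x) (at z)) 1+x≡y (adj (toℕ x) (subst (_≤ L) (sym 1+x≡y) (<⇒≤ (toℕ<n y))))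

      CycAdj⇒E : ∀ x y → CycAdj G x y → E (cycle x) (cycle y)
      CycAdj⇒E x y (inj₁ 1+x≡y) = forward 1+x≡y
      CycAdj⇒E x y (inj₂ (inj₁ 1+y≡x)) = E-sym (forward 1+y≡x)
      CycAdj⇒E x y (inj₂ (inj₂ (inj₁ (x≡0 , 1+y≡L)))) = E-sym (wrap x≡0 1+y≡L)
      CycAdj⇒E x y (inj₂ (inj₂ (inj₂ (y≡0 , 1+x≡L)))) = wrap y≡0 1+x≡L

  shortcutAt : (ℕ → V) → ℕ → ℕ → ℕ → V
  shortcutAt f i δ k with k ≤? i
  ... | yes _ = f k
  ... | no _ = f (k + δ)

  shortcut-below : ∀ f i δ {k} → k ≤ i → shortcutAt f i δ k ≡ f k
  shortcut-below f i δ {k} k≤i with k ≤? i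
  ... | yes _ = refl
  ... | no k≰i = ⊥-elim (k≰i k≤i)

  shortcut-above : ∀ f i δ {k} → i < k → shortcutAt f i δ k ≡ f (k + δ)
  shortcut-above f i δ {k} i<k with k ≤? i
  ... | yes k≤i = ⊥-elim (<⇒≱ i<k k≤i)
  ... | no _ = refl

  -- At k = i (possible only for e = 0) both readings agree because the hop stays put.
  shortcut-beyond : ∀ f i δ {e} → Hop e (f i) (f (i + δ + e)) → ∀ {k} → i + e ≤ k → shortcutAt f i δ k ≡ f (k + δ)
  shortcut-beyond f i δ hop {k} i+e≤k with k ≤? i
  ... | no _ = refl
  shortcut-beyond f i δ (stay eq) {k} i+0≤k | yes k≤i with ≤-antisym k≤i (≤-trans (≤-reflexive (sym (+-identityʳ i))) i+0≤k)
  ... | refl = trans eq (cong f (+-identityʳ (i + δ)))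
  shortcut-beyond f i δ (move _) {k} i+1≤k | yes k≤i = ⊥-elim (<⇒≱ (≤-trans (≤-reflexive (+-comm 1 i)) i+1≤k) k≤i)

  shortcut : ∀ {L} (w : ClosedWalk L) (i δ e L′ : ℕ) → Hop e (ClosedWalk.at w i) (ClosedWalk.at w (i + δ + e)) →
             L′ + δ ≡ L → i + e ≤ L′ → ClosedWalk L′
  shortcut {L} w i δ e L′ hop L′+δ≡L i+e≤L′ = record { at = at′ ; adj = adj′ ; closed = closed′ }
    where
      open ClosedWalk w
      at′ : ℕ → V
      at′ = shortcutAt at i δ

      shifted< : ∀ {k} → k < L′ → k + δ < L
      shifted< k<L′ = ≤-trans (+-monoˡ-≤ δ k<L′) (≤-reflexive L′+δ≡L)

      adj′ : ∀ k → k < L′ → E (at′ k) (at′ (suc k))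
      adj′ k k<L′ with <-cmp k i
      ... | tri< k<i _ _ = subst₂ E (sym (shortcut-below at i δ (<⇒≤ k<i))) (sym (shortcut-below at i δ k<i))
                             (adj k (<-≤-trans k<L′ (≤-trans (m≤m+n L′ δ) (≤-reflexive L′+δ≡L))))
      ... | tri> _ _ i<k = subst₂ E (sym (shortcut-above at i δ i<k)) (sym (shortcut-above at i δ (<-trans i<k (n<1+n k))))
                             (adj (k + δ) (shifted< k<L′))
      ... | tri≈ _ refl _ = subst₂ E (sym (shortcut-below at i δ ≤-refl)) (sym (shortcut-above at i δ (n<1+n i))) (jump e hop)
        where
          jump : ∀ e → Hop e (at i) (at (i + δ + e)) → E (at i) (at (suc i + δ))
          jump .0 (stay eq) = subst (λ z → E z (at (suc (i + δ)))) (sym (trans eq (cong at (+-identityʳ (i + δ)))))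
                                (adj (i + δ) (shifted< k<L′))
          jump .1 (move h) = subst (λ z → E (at i) (at z)) (+-comm (i + δ) 1) h

      closed′ : at′ L′ ≡ at′ 0
      closed′ = trans (shortcut-beyond at i δ hop i+e≤L′)
                  (trans (cong at L′+δ≡L) (trans closed (sym (shortcut-below at i δ z≤n))))

  rotateAt : (ℕ → V) → ℕ → ℕ → ℕ → V
  rotateAt f r s k with k ≤? s
  ... | yes _ = f (r + k)
  ... | no _ = f (k ∸ s)

  rotate-below : ∀ f r s {k} → k ≤ s → rotateAt f r s k ≡ f (r + k)
  rotate-below f r s {k} k≤s with k ≤? s
  ... | yes _ = refl
  ... | no k≰s = ⊥-elim (k≰s k≤s)

  rotate-above : ∀ f r s → f (r + s) ≡ f 0 → ∀ m → rotateAt f r s (s + m) ≡ f m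
  rotate-above f r s closes zero = trans (cong (rotateAt f r s) (+-identityʳ s)) (trans (rotate-below f r s ≤-refl) closes)
  rotate-above f r s closes (suc m) with s + suc m ≤? s
  ... | yes s+1+m≤s = ⊥-elim (<⇒≱ (m<m+n s z<s) s+1+m≤s)
  ... | no _ = cong f (m+n∸m≡n s (suc m))

  rotate : ∀ {L} (w : ClosedWalk L) (r s : ℕ) → L ≡ r + s → ClosedWalk L
  rotate {L} w r s L≡r+s = record { at = at′ ; adj = adj′ ; closed = closed′ }
    where
      open ClosedWalk w
      at′ : ℕ → V
      at′ = rotateAt at r s

      wrapped : ∀ m → at′ (s + m) ≡ at m
      wrapped = rotate-above at r s (trans (cong at (sym L≡r+s)) closed)

      adj′ : ∀ k → k < L → E (at′ k) (at′ (suc k))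
      adj′ k k<L with <-cmp k s
      ... | tri< k<s _ _ = subst₂ E (sym (rotate-below at r s (<⇒≤ k<s))) (sym (trans (rotate-below at r s k<s) (cong at (+-suc r k))))
                             (adj (r + k) (≤-trans (≤-reflexive (sym (+-suc r k))) (≤-trans (+-monoʳ-≤ r k<s) (≤-reflexive (sym L≡r+s)))))
      ... | tri≈ _ refl _ = subst₂ E (sym (trans (rotate-below at r s ≤-refl) (trans (cong at (sym L≡r+s)) closed)))
                              (sym (trans (cong at′ (+-comm 1 s)) (wrapped 1)))
                              (adj 0 (≤-trans (s≤s z≤n) k<L))
      ... | tri> _ _ s<k with m≤n⇒∃[o]m+o≡n s<k
      ...   | o , refl = subst₂ E (sym (trans (cong at′ (sym (+-suc s o))) (wrapped (suc o))))
                                  (sym (trans (cong (at′ ∘ suc) (sym (+-suc s o))) (trans (cong at′ (sym (+-suc s (suc o)))) (wrapped (suc (suc o))))))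
                                  (adj (suc o) (≤-trans (s≤s (s≤s (m≤n+m o s))) k<L))

      closed′ : at′ L ≡ at′ 0
      closed′ = trans (cong at′ (trans L≡r+s (+-comm r s))) (trans (wrapped r) (sym (trans (rotate-below at r s z≤n) (cong at (+-identityʳ r)))))

  vertexAt : ∀ {x y n} → Walk G x y n → ℕ → V
  vertexAt {x} here _ = x
  vertexAt {x} (step _ _) zero = x
  vertexAt (step _ p) (suc k) = vertexAt p k

  vertexAt-start : ∀ {x y n} (p : Walk G x y n) → vertexAt p 0 ≡ x
  vertexAt-start here = refl
  vertexAt-start (step _ _) = refl

  vertexAt-end : ∀ {x y n} (p : Walk G x y n) → vertexAt p n ≡ y
  vertexAt-end here = refl
  vertexAt-end (step _ p) = vertexAt-end p

  vertexAt-++ʷ : ∀ {x y z n m} (p : Walk G x y n) (q : Walk G y z m) {k} → k ≤ n → vertexAt (p ++ʷ q) k ≡ vertexAt p k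
  vertexAt-++ʷ here q z≤n = vertexAt-start q
  vertexAt-++ʷ (step _ _) q {zero} _ = refl
  vertexAt-++ʷ (step _ p) q {suc k} (s≤s k≤n) = vertexAt-++ʷ p q k≤n

  vertexAt-adj : ∀ {x y n} (p : Walk G x y n) i → i < n → E (vertexAt p i) (vertexAt p (suc i))
  vertexAt-adj (step xy p) zero _ = subst (E _) (sym (vertexAt-start p)) xy
  vertexAt-adj (step _ p) (suc i) (s≤s i<n) = vertexAt-adj p i i<n

  closedWalk : ∀ {x n} → Walk G x x n → ClosedWalk n
  closedWalk p = record { at = vertexAt p ; adj = vertexAt-adj p ; closed = trans (vertexAt-end p) (sym (vertexAt-start p)) }

m+m≤1+n+n⇒m≤n : ∀ m n → m + m ≤ suc (n + n) → m ≤ n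
m+m≤1+n+n⇒m≤n zero n _ = z≤n
m+m≤1+n+n⇒m≤n (suc m) zero m+m≤1 rewrite +-suc m m = ⊥-elim (<⇒≱ (s≤s (s≤s z≤n)) m+m≤1)
m+m≤1+n+n⇒m≤n (suc m) (suc n) h rewrite +-suc m m | +-suc n n = s≤s (m+m≤1+n+n⇒m≤n m n (≤-pred (≤-pred h)))

≤-by : ∀ {p s} q → p + q ≡ s → p ≤ s
≤-by {p} q p+q≡s = ≤-trans (m≤m+n p q) (≤-reflexive p+q≡s)

+-shift : ∀ {p′ p} d l → p′ + d ≡ p → p′ + l + d ≡ p + l
+-shift {p′} d l eq = trans (xy∙z≈xz∙y p′ l d) (cong (_+ l) eq)

sides-shrink : ∀ {a′ b′ a b} lc ld t → a′ + t ≤ a → b′ + t ≤ b → (a′ + lc) ⊔ (b′ + ld) + t ≤ (a + lc) ⊔ (b + ld)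
sides-shrink {a′} {b′} lc ld t a′+t≤a b′+t≤b =
  ≤-trans (≤-reflexive (+-distribʳ-⊔ t (a′ + lc) (b′ + ld)))
          (⊔-mono-≤ (shrink a′ lc a′+t≤a) (shrink b′ ld b′+t≤b))
  where
    shrink : ∀ {a} a′ l → a′ + t ≤ a → a′ + l + t ≤ a + l
    shrink a′ l a′+t≤a = ≤-trans (≤-reflexive (xy∙z≈xz∙y a′ l t)) (+-monoˡ-≤ l a′+t≤a)

p+l≤1+p : ∀ p {l} → l ≤ 1 → p + l ≤ suc p
p+l≤1+p p l≤1 = ≤-trans (+-monoʳ-≤ p l≤1) (≤-reflexive (+-comm p 1))

module Quadrangles {a b : Level} (G : Graph a b) (K : ℕ) where
  open Graph G renaming (sym to E-sym)
  open WalkCalculus G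

  data Corner (f : ℕ → V) (p l : ℕ) : V → Set a where
    first : Corner f p l (f p)
    last : Corner f p l (f (p + l))

  corner-⊆ : ∀ {f f′ : ℕ → V} {p p′ l l′ z} → f′ p′ ≡ f p → f′ (p′ + l′) ≡ f (p + l) → Corner f′ p′ l′ z → Corner f p l z
  corner-⊆ {f} {p = p} {l = l} first≡ _ first = subst (Corner f p l) (sym first≡) first
  corner-⊆ {f} {p = p} {l = l} _ last≡ last = subst (Corner f p l) (sym last≡) last

  _⊆_ : (V → Set a) → (V → Set a) → Set a
  P ⊆ Q = ∀ {z} → P z → Q z

  DistAtLeast : (V → Set a) → (V → Set a) → ℕ → Set (a Level.⊔ b)
  DistAtLeast P Q n = ∀ {p q m} → P p → Q q → Walk G p q m → n ≤ m

  Within : ℕ → (V → Set a) → (V → Set a) → Set (a Level.⊔ b)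
  Within t P Q = ∀ {z} → P z → Σ V λ x → Q x × Walk G x z t

  corner-shift : ∀ {f f′ : ℕ → V} {k₀ d p′ p l} → (∀ {k} → k₀ ≤ k → f′ k ≡ f (k + d)) → k₀ ≤ p′ → p′ + d ≡ p →
                 Corner f′ p′ l ⊆ Corner f p l
  corner-shift {f} {d = d} {p′} {l = l} shifted k₀≤p′ p′+d≡p =
    corner-⊆ (trans (shifted k₀≤p′) (cong f p′+d≡p))
             (trans (shifted (≤-trans k₀≤p′ (m≤m+n p′ l))) (cong f (+-shift d l p′+d≡p)))

  ⊆⇒Within : ∀ {P Q} → P ⊆ Q → Within 0 P Q
  ⊆⇒Within P⊆Q p = _ , P⊆Q p , here

  point-within : ∀ {Q : V → Set a} {f p w x t} → f p ≡ w → Q x → Walk G x w t → Within t (Corner f p 0) Q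
  point-within fp≡w x∈Q x→w first = _ , x∈Q , castʷ refl (sym fp≡w) x→w
  point-within {f = f} {p} fp≡w x∈Q x→w last = _ , x∈Q , castʷ refl (sym (trans (cong f (+-identityʳ p)) fp≡w)) x→w

  corner₀ : ∀ {f : ℕ → V} {p z} → Corner f p 0 z → z ≡ f p
  corner₀ first = refl
  corner₀ {f} {p} last = cong f (+-identityʳ p)

  DistAtLeast-mono : ∀ {P P′ Q Q′ n} → P′ ⊆ P → Q′ ⊆ Q → DistAtLeast P Q n → DistAtLeast P′ Q′ n
  DistAtLeast-mono P′⊆P Q′⊆Q P↔Q p q w = P↔Q (P′⊆P p) (Q′⊆Q q) w

  DistAtLeast-sym : ∀ {P Q n} → DistAtLeast P Q n → DistAtLeast Q P n
  DistAtLeast-sym P↔Q q p w = P↔Q p q (reverseʷ w)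

  DistAtLeast-within : ∀ {P P′ Q m} t → Within t P′ P → DistAtLeast P Q m → DistAtLeast P′ Q (m ∸ t)
  DistAtLeast-within t P′≈P P↔Q {q = q} {m = len} p′ q∈Q w with P′≈P p′
  ... | x , x∈P , x→p′ = ≤-trans (∸-monoˡ-≤ t (P↔Q x∈P q∈Q (x→p′ ++ʷ w))) (≤-reflexive (m+n∸m≡n t len))

  -- A closed walk of length L read as the quadrangle U A X B V C Y D: the corners
  -- U, X, V, Y are single vertices or edges (length ≤ 1), A, B, C, D the sides.
  record Quadrangle (lu la lx lb lv lc ly ld : ℕ) : Set (a Level.⊔ b) where
    field
      L : ℕ
      walk : ClosedWalk L
      length : L ≡ lu + la + lx + lb + lv + lc + ly + ld
      lu≤1 : lu ≤ 1
      lx≤1 : lx ≤ 1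
      lv≤1 : lv ≤ 1
      ly≤1 : ly ≤ 1

    open ClosedWalk walk public

    cornerU cornerX cornerV cornerY : V → Set a
    cornerU = Corner at 0 lu
    cornerX = Corner at (lu + la) lx
    cornerV = Corner at (lu + la + lx + lb) lv
    cornerY = Corner at (lu + la + lx + lb + lv + lc) ly

    Bounded : Set (a Level.⊔ b)
    Bounded = ∀ n m → DistAtLeast cornerU cornerV n → DistAtLeast cornerX cornerY m → n + m ≤ (la + lc) ⊔ (lb + ld) + K

    ≡L : ∀ {s} → s ≡ lu + la + lx + lb + lv + lc + ly + ld → s ≡ L
    ≡L s≡ = trans s≡ (sym length)

    ≤L : ∀ {p} q → p + q ≡ lu + la + lx + lb + lv + lc + ly + ld → p ≤ L
    ≤L q p+q≡ = ≤-by q (≡L p+q≡)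

    x₀≤L : lu + la ≤ L
    x₀≤L = ≤L (lx + lb + lv + lc + ly + ld) (solve (lu ∷ la ∷ lx ∷ lb ∷ lv ∷ lc ∷ ly ∷ ld ∷ []))

    v₀≤L : lu + la + lx + lb ≤ L
    v₀≤L = ≤L (lv + lc + ly + ld) (solve (lu ∷ la ∷ lx ∷ lb ∷ lv ∷ lc ∷ ly ∷ ld ∷ []))

    y₀≤L : lu + la + lx + lb + lv + lc ≤ L
    y₀≤L = ≤L (ly + ld) (solve (lu ∷ la ∷ lx ∷ lb ∷ lv ∷ lc ∷ ly ∷ ld ∷ []))

  open Quadrangle public using (Bounded)

  ShorterBounded : ℕ → Set (a Level.⊔ b)
  ShorterBounded L = ∀ {lu la lx lb lv lc ly ld} (c : Quadrangle lu la lx lb lv lc ly ld) → Quadrangle.L c < L → Bounded c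

  module _ {lu la lx lb lv lc ly ld : ℕ} where

    short⇒bounded : (c : Quadrangle lu la lx lb lv lc ly ld) → Quadrangle.L c ≤ suc (K + K) → Bounded c
    short⇒bounded c L≤2K+1 n m U↔V X↔Y = m+m≤1+n+n⇒m≤n (n + m) (M + K) (begin
        (n + m) + (n + m)                          ≡⟨ solve (n ∷ m ∷ []) ⟩
        (n + n) + (m + m)                          ≤⟨ +-mono-≤ (+-mono-≤ n≤a+x+b n≤c+y+d) (+-mono-≤ m≤b+v+c m≤u+a+d) ⟩
        (la + lx + lb) + (lc + ly + ld) + ((lb + lv + lc) + (lu + la + ld))
          ≡⟨ solve (lu ∷ la ∷ lx ∷ lb ∷ lv ∷ lc ∷ ly ∷ ld ∷ []) ⟩
        (la + lc) + (lb + ld) + (lu + la + lx + lb + lv + lc + ly + ld) ≡⟨ cong ((la + lc) + (lb + ld) +_) (sym length) ⟩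
        (la + lc) + (lb + ld) + L                  ≤⟨ +-mono-≤ (+-mono-≤ (m≤m⊔n (la + lc) (lb + ld)) (m≤n⊔m (la + lc) (lb + ld))) L≤2K+1 ⟩
        M + M + suc (K + K)                        ≡⟨ regroup M K ⟩
        suc ((M + K) + (M + K))                    ∎)
      where
        open Quadrangle c
        open ≤-Reasoning
        M : ℕ
        M = (la + lc) ⊔ (lb + ld)
        regroup : ∀ M K → M + M + suc (K + K) ≡ suc ((M + K) + (M + K))
        regroup M K = solve (M ∷ K ∷ [])
        n≤a+x+b : n ≤ la + lx + lb
        n≤a+x+b = U↔V last first
          (segment lu (la + lx + lb) _ (solve (lu ∷ la ∷ lx ∷ lb ∷ [])) v₀≤L)
        n≤c+y+d : n ≤ lc + ly + ld
        n≤c+y+d = U↔V first last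
          (castʷ closed refl (reverseʷ (segment (lu + la + lx + lb + lv) (lc + ly + ld) L
            (≡L (solve (lu ∷ la ∷ lx ∷ lb ∷ lv ∷ lc ∷ ly ∷ ld ∷ []))) ≤-refl)))
        m≤b+v+c : m ≤ lb + lv + lc
        m≤b+v+c = X↔Y last first
          (segment (lu + la + lx) (lb + lv + lc) _ (solve (lu ∷ la ∷ lx ∷ lb ∷ lv ∷ lc ∷ [])) y₀≤L)
        m≤u+a+d : m ≤ lu + la + ld
        m≤u+a+d = X↔Y first last
          (reverseʷ (segment 0 (lu + la) (lu + la) refl x₀≤L)
            ++ʷ castʷ closed refl (reverseʷ (segment (lu + la + lx + lb + lv + lc + ly) ld L (sym length) ≤-refl)))

  bounded-transfer : ∀ {lu la lx lb lv lc ly ld lu′ la′ lx′ lb′ lv′ lc′ ly′ ld′}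
    (c : Quadrangle lu la lx lb lv lc ly ld) (c′ : Quadrangle lu′ la′ lx′ lb′ lv′ lc′ ly′ ld′) (t : ℕ) →
    Quadrangle.cornerU c′ ⊆ Quadrangle.cornerU c → Quadrangle.cornerV c′ ⊆ Quadrangle.cornerV c →
    Quadrangle.cornerY c′ ⊆ Quadrangle.cornerY c → Within t (Quadrangle.cornerX c′) (Quadrangle.cornerX c) →
    (la′ + lc′) ⊔ (lb′ + ld′) + t ≤ (la + lc) ⊔ (lb + ld) → Bounded c′ → Bounded c
  bounded-transfer {la = la} {lb = lb} {lc = lc} {ld = ld} {la′ = la′} {lb′ = lb′} {lc′ = lc′} {ld′ = ld′}
    c c′ t U′⊆U V′⊆V Y′⊆Y X′≈X sides′+t≤sides bounded′ n m U↔V X↔Y = begin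
      n + m                 ≤⟨ +-monoʳ-≤ n (m≤n+m∸n m t) ⟩
      n + (t + (m ∸ t))     ≡⟨ x∙yz≈xz∙y n t (m ∸ t) ⟩
      n + (m ∸ t) + t       ≤⟨ +-monoˡ-≤ t (bounded′ n (m ∸ t) U′↔V′ X′↔Y′) ⟩
      S′ + K + t            ≡⟨ xy∙z≈xz∙y S′ K t ⟩
      S′ + t + K            ≤⟨ +-monoˡ-≤ K sides′+t≤sides ⟩
      (la + lc) ⊔ (lb + ld) + K ∎
    where
      open ≤-Reasoning
      S′ : ℕ
      S′ = (la′ + lc′) ⊔ (lb′ + ld′)
      U′↔V′ : DistAtLeast (Quadrangle.cornerU c′) (Quadrangle.cornerV c′) n
      U′↔V′ = DistAtLeast-mono U′⊆U V′⊆V U↔V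
      X′↔Y′ : DistAtLeast (Quadrangle.cornerX c′) (Quadrangle.cornerY c′) (m ∸ t)
      X′↔Y′ = DistAtLeast-within t X′≈X (DistAtLeast-mono (λ x → x) Y′⊆Y X↔Y)

  module _ {lu la lx lb lv lc ly ld : ℕ} (c : Quadrangle lu la lx lb lv lc ly ld) where
    open Quadrangle c hiding (Bounded)

    L≡x₀+rest : L ≡ lu + la + (lx + lb + lv + lc + ly + ld)
    L≡x₀+rest = sym (≡L (solve (lu ∷ la ∷ lx ∷ lb ∷ lv ∷ lc ∷ ly ∷ ld ∷ [])))

    rotation : Quadrangle lx lb lv lc ly ld lu la
    rotation = record
      { L = L
      ; walk = rotate walk (lu + la) (lx + lb + lv + lc + ly + ld) L≡x₀+rest
      ; length = trans length (solve (lu ∷ la ∷ lx ∷ lb ∷ lv ∷ lc ∷ ly ∷ ld ∷ []))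
      ; lu≤1 = lx≤1 ; lx≤1 = lv≤1 ; lv≤1 = ly≤1 ; ly≤1 = lu≤1 }

    private
      at′ : ℕ → V
      at′ = Quadrangle.at rotation

    rotated : ∀ q {q₀} → q ≤ lx + lb + lv + lc + ly + ld → lu + la + q ≡ q₀ → at′ q ≡ at q₀
    rotated q q≤s eq = trans (rotate-below at (lu + la) _ q≤s) (cong at eq)

    wrapped : ∀ m → at′ (lx + lb + lv + lc + ly + ld + m) ≡ at m
    wrapped = rotate-above at (lu + la) (lx + lb + lv + lc + ly + ld) (trans (cong at (sym L≡x₀+rest)) closed)

    bounded-rotation : Bounded rotation → Bounded c
    bounded-rotation bounded n m U↔V X↔Y =
      subst₂ _≤_ (+-comm m n) (cong (_+ K) (trans (cong ((lb + ld) ⊔_) (+-comm lc la)) (⊔-comm (lb + ld) (la + lc))))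
        (bounded m n (DistAtLeast-mono X′⊆X Y′⊆Y X↔Y) (DistAtLeast-mono V′⊆V U′⊆U (DistAtLeast-sym U↔V)))
      where
        X′⊆X : Quadrangle.cornerU rotation ⊆ cornerX
        X′⊆X = corner-⊆ (rotated 0 z≤n (+-identityʳ (lu + la)))
                        (rotated lx (≤-by (lb + lv + lc + ly + ld) (solve (lx ∷ lb ∷ lv ∷ lc ∷ ly ∷ ld ∷ []))) refl)
        Y′⊆Y : Quadrangle.cornerV rotation ⊆ cornerY
        Y′⊆Y = corner-⊆ (rotated (lx + lb + lv + lc) (≤-by (ly + ld) (solve (lx ∷ lb ∷ lv ∷ lc ∷ ly ∷ ld ∷ [])))
                                 (solve (lu ∷ la ∷ lx ∷ lb ∷ lv ∷ lc ∷ [])))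
                        (rotated (lx + lb + lv + lc + ly) (≤-by ld refl) (solve (lu ∷ la ∷ lx ∷ lb ∷ lv ∷ lc ∷ ly ∷ [])))
        V′⊆V : Quadrangle.cornerX rotation ⊆ cornerV
        V′⊆V = corner-⊆ (rotated (lx + lb) (≤-by (lv + lc + ly + ld) (solve (lx ∷ lb ∷ lv ∷ lc ∷ ly ∷ ld ∷ [])))
                                 (solve (lu ∷ la ∷ lx ∷ lb ∷ [])))
                        (rotated (lx + lb + lv) (≤-by (lc + ly + ld) (solve (lx ∷ lb ∷ lv ∷ lc ∷ ly ∷ ld ∷ [])))
                                 (solve (lu ∷ la ∷ lx ∷ lb ∷ lv ∷ [])))
        U′⊆U : Quadrangle.cornerY rotation ⊆ cornerU
        U′⊆U = corner-⊆ (trans (cong at′ (sym (+-identityʳ (lx + lb + lv + lc + ly + ld)))) (wrapped 0)) (wrapped lu)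

    rest≤L : lx + lb + lv + lc + ly + ld ≤ L
    rest≤L = ≤-trans (m≤n+m _ (lu + la)) (≤-reflexive (sym L≡x₀+rest))

    record ChordOfRotation (p e : ℕ) : Set (a Level.⊔ b) where
      field
        j : ℕ
        hop : Hop e (Quadrangle.at rotation p) (Quadrangle.at rotation j)
        gap : p + suc e ≤ j
        j≤rest : j ≤ lx + lb + lv + lc + ly + ld

    chord-in-rotation : ∀ p {i j e} → lu + la + p ≡ i → Hop e (at i) (at j) → i + suc e ≤ j → j ≤ L → ChordOfRotation p e
    chord-in-rotation p {e = e} refl hop gap j≤L
      with m≤n⇒∃[o]m+o≡n (≤-trans (m≤m+n (lu + la) (p + suc e)) (≤-trans (≤-reflexive (sym (+-assoc (lu + la) p (suc e)))) gap))
    ... | j′ , refl = record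
      { j = j′
      ; hop = hop-cast (sym (rotated p (≤-trans (≤-trans (m≤m+n p (suc e)) gap′) j′≤rest) refl)) (sym (rotated j′ j′≤rest refl)) hop
      ; gap = gap′
      ; j≤rest = j′≤rest }
      where
        gap′ : p + suc e ≤ j′
        gap′ = +-cancelˡ-≤ (lu + la) _ _ (≤-trans (≤-reflexive (sym (+-assoc (lu + la) p (suc e)))) gap)
        j′≤rest : j′ ≤ lx + lb + lv + lc + ly + ld
        j′≤rest = +-cancelˡ-≤ (lu + la) _ _ (≤-trans j≤L (≤-reflexive L≡x₀+rest))


  module _ {lu la lx lb lv lc ly ld : ℕ} (c : Quadrangle lu la lx lb lv lc ly ld) where
    open Quadrangle c hiding (Bounded)

    -- Cutting out the stretch between positions lu + α and lu + α + suc δ + e, which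
    -- lies between the corners U and V, only moves the corner X.
    bounded-by-shortcut : ShorterBounded L → (α δ e β la′ lx′ lb′ t : ℕ) →
      Hop e (at (lu + α)) (at (lu + α + suc δ + e)) →
      la + lx + lb ≡ α + suc δ + e + β → la′ + lx′ + lb′ ≡ α + e + β → lx′ ≤ 1 →
      Within t (Corner (shortcutAt at (lu + α) (suc δ)) (lu + la′) lx′) cornerX →
      (la′ + lc) ⊔ (lb′ + ld) + t ≤ (la + lc) ⊔ (lb + ld) → Bounded c
    bounded-by-shortcut IH α δ e β la′ lx′ lb′ t hop sum sum′ lx′≤1 X′≈X sides′+t≤sides =
      bounded-transfer c c′ t U′⊆U (corner-shift beyond i+e≤v₀′ v₀′+δ≡v₀)
        (corner-shift beyond (≤-trans i+e≤v₀′ (≤-trans (m≤m+n _ lv) (m≤m+n _ lc))) (+-shift (suc δ) lc (+-shift (suc δ) lv v₀′+δ≡v₀)))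
        X′≈X sides′+t≤sides (IH c′ shorter)
      where
        open ≡-Reasoning
        v₀′+δ≡v₀ : lu + la′ + lx′ + lb′ + suc δ ≡ lu + la + lx + lb
        v₀′+δ≡v₀ = begin
          lu + la′ + lx′ + lb′ + suc δ    ≡⟨ solve (lu ∷ la′ ∷ lx′ ∷ lb′ ∷ δ ∷ []) ⟩
          lu + (la′ + lx′ + lb′) + suc δ  ≡⟨ cong (λ s → lu + s + suc δ) sum′ ⟩
          lu + (α + e + β) + suc δ        ≡⟨ solve (lu ∷ α ∷ e ∷ β ∷ δ ∷ []) ⟩
          lu + (α + suc δ + e + β)        ≡⟨ cong (lu +_) (sym sum) ⟩
          lu + (la + lx + lb)             ≡⟨ solve (lu ∷ la ∷ lx ∷ lb ∷ []) ⟩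
          lu + la + lx + lb               ∎
        i+e≤v₀′ : lu + α + e ≤ lu + la′ + lx′ + lb′
        i+e≤v₀′ = ≤-by β (begin
          lu + α + e + β        ≡⟨ solve (lu ∷ α ∷ e ∷ β ∷ []) ⟩
          lu + (α + e + β)      ≡⟨ cong (lu +_) (sym sum′) ⟩
          lu + (la′ + lx′ + lb′) ≡⟨ solve (lu ∷ la′ ∷ lx′ ∷ lb′ ∷ []) ⟩
          lu + la′ + lx′ + lb′  ∎)
        L′ : ℕ
        L′ = lu + la′ + lx′ + lb′ + lv + lc + ly + ld
        L′+δ≡L : L′ + suc δ ≡ L
        L′+δ≡L = ≡L (+-shift (suc δ) ld (+-shift (suc δ) ly (+-shift (suc δ) lc (+-shift (suc δ) lv v₀′+δ≡v₀))))
        i+e≤L′ : lu + α + e ≤ lu + la′ + lx′ + lb′ + lv + lc + ly + ld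
        i+e≤L′ = ≤-trans i+e≤v₀′ (≤-by (lv + lc + ly + ld) (solve (lu ∷ la′ ∷ lx′ ∷ lb′ ∷ lv ∷ lc ∷ ly ∷ ld ∷ [])))
        c′ : Quadrangle lu la′ lx′ lb′ lv lc ly ld
        c′ = record
          { L = L′
          ; walk = shortcut walk (lu + α) (suc δ) e L′ hop L′+δ≡L i+e≤L′
          ; length = refl
          ; lu≤1 = lu≤1 ; lx≤1 = lx′≤1 ; lv≤1 = lv≤1 ; ly≤1 = ly≤1 }
        shorter : L′ < L
        shorter = subst (L′ <_) L′+δ≡L (m<m+n L′ z<s)
        beyond : ∀ {k} → lu + α + e ≤ k → shortcutAt at (lu + α) (suc δ) k ≡ at (k + suc δ)
        beyond = shortcut-beyond at (lu + α) (suc δ) hop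
        U′⊆U : Quadrangle.cornerU c′ ⊆ cornerU
        U′⊆U = corner-⊆ (shortcut-below at (lu + α) (suc δ) z≤n) (shortcut-below at (lu + α) (suc δ) (m≤m+n lu α))

    bounded-if-chord-A-A : ShorterBounded L → (α δ e β : ℕ) → la ≡ α + suc δ + e + β →
      Hop e (at (lu + α)) (at (lu + α + suc δ + e)) → Bounded c
    bounded-if-chord-A-A IH α δ e β la≡ hop =
      bounded-by-shortcut IH α δ e (β + lx + lb) (α + e + β) lx lb 0 hop sum sum′ lx≤1
        (⊆⇒Within (corner-shift (shortcut-beyond at (lu + α) (suc δ) hop) i+e≤X′ X′+δ≡X))
        (sides-shrink lc ld 0 (≤-trans (≤-reflexive (+-identityʳ _)) (≤-by (suc δ) a′+δ≡a)) (≤-reflexive (+-identityʳ lb)))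
      where
        open ≡-Reasoning
        sum : la + lx + lb ≡ α + suc δ + e + (β + lx + lb)
        sum = begin
          la + lx + lb                  ≡⟨ cong (λ a → a + lx + lb) la≡ ⟩
          α + suc δ + e + β + lx + lb   ≡⟨ solve (α ∷ δ ∷ e ∷ β ∷ lx ∷ lb ∷ []) ⟩
          α + suc δ + e + (β + lx + lb) ∎
        sum′ : α + e + β + lx + lb ≡ α + e + (β + lx + lb)
        sum′ = solve (α ∷ e ∷ β ∷ lx ∷ lb ∷ [])
        i+e≤X′ : lu + α + e ≤ lu + (α + e + β)
        i+e≤X′ = ≤-by β (solve (lu ∷ α ∷ e ∷ β ∷ []))
        a′+δ≡a : α + e + β + suc δ ≡ la
        a′+δ≡a = begin
          α + e + β + suc δ ≡⟨ solve (α ∷ δ ∷ e ∷ β ∷ []) ⟩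
          α + suc δ + e + β ≡⟨ sym la≡ ⟩
          la                ∎
        X′+δ≡X : lu + (α + e + β) + suc δ ≡ lu + la
        X′+δ≡X = trans (+-assoc lu (α + e + β) (suc δ)) (cong (lu +_) a′+δ≡a)

    module ChordFromAToB (IH : ShorterBounded L) (α t₁ t₂ β δ e : ℕ) (la≡ : la ≡ α + t₁) (lb≡ : lb ≡ t₂ + β)
      (t₁+x+t₂≡ : t₁ + lx + t₂ ≡ suc δ + e) (hop : Hop e (at (lu + α)) (at (lu + α + suc δ + e))) where
      open ≡-Reasoning

      sum : la + lx + lb ≡ α + suc δ + e + β
      sum = begin
        la + lx + lb            ≡⟨ cong₂ (λ a b → a + lx + b) la≡ lb≡ ⟩
        α + t₁ + lx + (t₂ + β)  ≡⟨ solve (α ∷ t₁ ∷ lx ∷ t₂ ∷ β ∷ []) ⟩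
        α + (t₁ + lx + t₂) + β  ≡⟨ cong (λ t → α + t + β) t₁+x+t₂≡ ⟩
        α + (suc δ + e) + β     ≡⟨ solve (α ∷ δ ∷ e ∷ β ∷ []) ⟩
        α + suc δ + e + β       ∎

      X→i : Walk G (at (lu + la)) (at (lu + α)) t₁
      X→i = reverseʷ (segment (lu + α) t₁ (lu + la) (trans (+-assoc lu α t₁) (cong (lu +_) (sym la≡))) x₀≤L)

      X′→j : Walk G (at (lu + la + lx)) (at (lu + α + suc δ + e)) t₂
      X′→j = segment (lu + la + lx) t₂ _ x′+t₂≡j (≤-trans (≤-by β j+β≡v₀) v₀≤L)
        where
          x′+t₂≡j : lu + la + lx + t₂ ≡ lu + α + suc δ + e
          x′+t₂≡j = begin
            lu + la + lx + t₂         ≡⟨ cong (λ a → lu + a + lx + t₂) la≡ ⟩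
            lu + (α + t₁) + lx + t₂   ≡⟨ solve (lu ∷ α ∷ t₁ ∷ lx ∷ t₂ ∷ []) ⟩
            lu + α + (t₁ + lx + t₂)   ≡⟨ cong (lu + α +_) t₁+x+t₂≡ ⟩
            lu + α + (suc δ + e)      ≡⟨ solve (lu ∷ α ∷ δ ∷ e ∷ []) ⟩
            lu + α + suc δ + e        ∎
          j+β≡v₀ : lu + α + suc δ + e + β ≡ lu + la + lx + lb
          j+β≡v₀ = begin
            lu + α + suc δ + e + β    ≡⟨ solve (lu ∷ α ∷ δ ∷ e ∷ β ∷ []) ⟩
            lu + (α + suc δ + e + β)  ≡⟨ cong (lu +_) (sym sum) ⟩
            lu + (la + lx + lb)       ≡⟨ solve (lu ∷ la ∷ lx ∷ lb ∷ []) ⟩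
            lu + la + lx + lb         ∎

      at′ : ℕ → V
      at′ = shortcutAt at (lu + α) (suc δ)

      at′i : at′ (lu + α) ≡ at (lu + α)
      at′i = shortcut-below at (lu + α) (suc δ) ≤-refl

      at′-after : at′ (lu + α + e) ≡ at (lu + α + suc δ + e)
      at′-after = trans (shortcut-beyond at (lu + α) (suc δ) hop ≤-refl) (cong at (solve (lu ∷ α ∷ e ∷ δ ∷ [])))

      cut : ∀ la′ lx′ lb′ t → la′ + lx′ + lb′ ≡ α + e + β → lx′ ≤ 1 → Within t (Corner at′ (lu + la′) lx′) cornerX →
            la′ + t ≤ α + t₁ → lb′ + t ≤ t₂ + β → Bounded c
      cut la′ lx′ lb′ t sum′ lx′≤1 X′≈X a′+t≤a b′+t≤b =
        bounded-by-shortcut IH α δ e β la′ lx′ lb′ t hop sum sum′ lx′≤1 X′≈X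
          (sides-shrink lc ld t (≤-trans a′+t≤a (≤-reflexive (sym la≡))) (≤-trans b′+t≤b (≤-reflexive (sym lb≡))))

    -- The new corner X is the hop itself or one of its ends, chosen so that the sides shrink by
    -- at least the distance t from the old corner X.
    bounded-if-chord-A-B : ShorterBounded L → (α t₁ t₂ β δ e : ℕ) → la ≡ α + t₁ → lb ≡ t₂ + β → t₁ + lx + t₂ ≡ suc δ + e →
      Hop e (at (lu + α)) (at (lu + α + suc δ + e)) → Bounded c
    bounded-if-chord-A-B IH α t₁ t₂ β δ .1 la≡ lb≡ t≡ (move h) with <-cmp t₁ t₂
    ... | tri≈ _ refl _ = cut α 1 β t₁ refl ≤-refl X′≈X ≤-refl (≤-reflexive (+-comm β t₁))
      where
        open ChordFromAToB IH α t₁ t₁ β δ 1 la≡ lb≡ t≡ (move h)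
        X′≈X : Within t₁ (Corner at′ (lu + α) 1) cornerX
        X′≈X first = _ , first , castʷ refl (sym at′i) X→i
        X′≈X last = _ , last , castʷ refl (sym at′-after) X′→j
    ... | tri< t₁<t₂ _ _ = cut α 0 (suc β) t₁ (solve (α ∷ β ∷ [])) z≤n (point-within at′i first X→i)
                             ≤-refl (≤-trans (≤-reflexive (cong suc (+-comm β t₁))) (+-monoˡ-≤ β t₁<t₂))
      where open ChordFromAToB IH α t₁ t₂ β δ 1 la≡ lb≡ t≡ (move h)
    ... | tri> _ _ t₂<t₁ = cut (suc α) 0 β t₂ (solve (α ∷ β ∷ [])) z≤n (point-within at′j last X′→j)
                             (≤-trans (≤-reflexive (sym (+-suc α t₂))) (+-monoʳ-≤ α t₂<t₁)) (≤-reflexive (+-comm β t₂))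
      where
        open ChordFromAToB IH α t₁ t₂ β δ 1 la≡ lb≡ t≡ (move h)
        at′j : at′ (lu + suc α) ≡ at (lu + α + suc δ + 1)
        at′j = trans (cong at′ (trans (+-suc lu α) (+-comm 1 (lu + α)))) at′-after
    bounded-if-chord-A-B IH α t₁ t₂ β δ .0 la≡ lb≡ t≡ (stay eq) with t₁ ≤? t₂
    ... | yes t₁≤t₂ = cut α 0 β t₁ refl z≤n (point-within at′i first X→i)
                        ≤-refl (≤-trans (≤-reflexive (+-comm β t₁)) (+-monoˡ-≤ β t₁≤t₂))
      where open ChordFromAToB IH α t₁ t₂ β δ 0 la≡ lb≡ t≡ (stay eq)
    ... | no t₁≰t₂ = cut α 0 β t₂ refl z≤n (point-within (trans (cong at′ (sym (+-identityʳ (lu + α)))) at′-after) last X′→j)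
                       (+-monoʳ-≤ α (<⇒≤ (≰⇒> t₁≰t₂))) (≤-reflexive (+-comm β t₂))
      where open ChordFromAToB IH α t₁ t₂ β δ 0 la≡ lb≡ t≡ (stay eq)

    -- A chord from side A to side C splits the quadrangle into two paths that bound both diagonals.
    bounded-if-chord-A-C : 2 ≤ K → (α α′ γ γ′ e : ℕ) → la ≡ α + α′ → lc ≡ γ + γ′ →
      Hop e (at (lu + α)) (at (lu + la + lx + lb + lv + γ)) → Bounded c
    bounded-if-chord-A-C 2≤K α α′ γ γ′ e la≡ lc≡ hop n m U↔V X↔Y = begin
      n + m                         ≤⟨ +-mono-≤ (U↔V last last U→V) (X↔Y first first X→Y) ⟩
      (α + e + γ) + (α′ + e + γ′)   ≡⟨ solve (α ∷ α′ ∷ γ ∷ γ′ ∷ e ∷ []) ⟩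
      (α + α′) + (γ + γ′) + (e + e) ≡⟨ cong₂ (λ a c → a + c + (e + e)) (sym la≡) (sym lc≡) ⟩
      la + lc + (e + e)             ≤⟨ +-mono-≤ (m≤m⊔n (la + lc) (lb + ld)) e+e≤K ⟩
      (la + lc) ⊔ (lb + ld) + K     ∎
      where
        open ≤-Reasoning
        v₁ : ℕ
        v₁ = lu + la + lx + lb + lv
        e+e≤K : e + e ≤ K
        e+e≤K = ≤-trans (+-mono-≤ (hop≤1 hop) (hop≤1 hop)) 2≤K
        i+α′≡x₀ : lu + α + α′ ≡ lu + la
        i+α′≡x₀ = trans (+-assoc lu α α′) (cong (lu +_) (sym la≡))
        j+γ′≡y₀ : v₁ + γ + γ′ ≡ v₁ + lc
        j+γ′≡y₀ = trans (+-assoc v₁ γ γ′) (cong (v₁ +_) (sym lc≡))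
        j≤L : v₁ + γ ≤ L
        j≤L = ≤-trans (≤-by γ′ j+γ′≡y₀) y₀≤L
        U→V : Walk G (at lu) (at v₁) (α + e + γ)
        U→V = segment lu α (lu + α) refl (≤-trans (≤-by α′ i+α′≡x₀) x₀≤L)
              ++ʷ hop⇒walk hop ++ʷ reverseʷ (segment v₁ γ (v₁ + γ) refl j≤L)
        X→Y : Walk G (at (lu + la)) (at (v₁ + lc)) (α′ + e + γ′)
        X→Y = reverseʷ (segment (lu + α) α′ (lu + la) i+α′≡x₀ x₀≤L)
              ++ʷ hop⇒walk hop ++ʷ segment (v₁ + γ) γ′ (v₁ + lc) j+γ′≡y₀ y₀≤L

module ChordCases {a b : Level} (G : Graph a b) (K : ℕ) (2≤K : 2 ≤ K) where
  open Graph G renaming (sym to E-sym)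
  open WalkCalculus G
  open Quadrangles G K

  module _ {lu la lx lb lv lc ly ld : ℕ} (c : Quadrangle lu la lx lb lv lc ly ld) (IH : ShorterBounded (Quadrangle.L c)) where
    open Quadrangle c hiding (Bounded)

    bounded-if-chord-from-A-to-ABC : ∀ α j e → Hop e (at (lu + α)) (at j) → α ≤ la → lu + α + suc e ≤ j →
      j ≤ lu + la + lx + lb + lv + lc → Bounded c
    bounded-if-chord-from-A-to-ABC α j e hop α≤la gap j≤y₀ with m≤n⇒∃[o]m+o≡n gap
    ... | δ , refl with m≤n⇒∃[o]m+o≡n α≤la | lu + α + suc e + δ ≤? lu + la | lu + α + suc e + δ ≤? lu + la + lx + lb
    ...   | t₁ , α+t₁≡la | yes j≤x₀ | _ with m≤n⇒∃[o]m+o≡n j≤x₀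
    ...     | β , j+β≡x₀ = bounded-if-chord-A-A c IH α δ e β (+-cancelˡ-≡ lu _ _ la≡) (hop-cast refl (cong at j≡) hop)
      where
        open ≡-Reasoning
        j≡ : lu + α + suc e + δ ≡ lu + α + suc δ + e
        j≡ = solve (lu ∷ α ∷ e ∷ δ ∷ [])
        la≡ : lu + la ≡ lu + (α + suc δ + e + β)
        la≡ = begin
          lu + la                   ≡⟨ sym j+β≡x₀ ⟩
          lu + α + suc e + δ + β    ≡⟨ solve (lu ∷ α ∷ e ∷ δ ∷ β ∷ []) ⟩
          lu + (α + suc δ + e + β)  ∎
    bounded-if-chord-from-A-to-ABC α _ e hop α≤la gap j≤y₀ | δ , refl | t₁ , α+t₁≡la | no j≰x₀ | yes j≤v₀
      with m≤n⇒∃[o]m+o≡n (≤-trans (p+l≤1+p (lu + la) lx≤1) (≰⇒> j≰x₀)) | m≤n⇒∃[o]m+o≡n j≤v₀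
    ... | t₂ , x₁+t₂≡j | β , j+β≡v₀ =
      bounded-if-chord-A-B c IH α t₁ t₂ β δ e (sym α+t₁≡la) (+-cancelˡ-≡ (lu + la + lx) _ _ lb≡)
        (+-cancelˡ-≡ (lu + α) _ _ t≡) (hop-cast refl (cong at j≡) hop)
      where
        open ≡-Reasoning
        j≡ : lu + α + suc e + δ ≡ lu + α + suc δ + e
        j≡ = solve (lu ∷ α ∷ e ∷ δ ∷ [])
        lb≡ : lu + la + lx + lb ≡ lu + la + lx + (t₂ + β)
        lb≡ = begin
          lu + la + lx + lb         ≡⟨ sym j+β≡v₀ ⟩
          lu + α + suc e + δ + β    ≡⟨ cong (_+ β) (sym x₁+t₂≡j) ⟩
          lu + la + lx + t₂ + β     ≡⟨ +-assoc (lu + la + lx) t₂ β ⟩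
          lu + la + lx + (t₂ + β)   ∎
        t≡ : lu + α + (t₁ + lx + t₂) ≡ lu + α + (suc δ + e)
        t≡ = begin
          lu + α + (t₁ + lx + t₂)   ≡⟨ solve (lu ∷ α ∷ t₁ ∷ lx ∷ t₂ ∷ []) ⟩
          lu + (α + t₁) + lx + t₂   ≡⟨ cong (λ a → lu + a + lx + t₂) α+t₁≡la ⟩
          lu + la + lx + t₂         ≡⟨ x₁+t₂≡j ⟩
          lu + α + suc e + δ        ≡⟨ solve (lu ∷ α ∷ e ∷ δ ∷ []) ⟩
          lu + α + (suc δ + e)      ∎
    bounded-if-chord-from-A-to-ABC α _ e hop α≤la gap j≤y₀ | δ , refl | t₁ , α+t₁≡la | no _ | no j≰v₀
      with m≤n⇒∃[o]m+o≡n (≤-trans (p+l≤1+p (lu + la + lx + lb) lv≤1) (≰⇒> j≰v₀)) | m≤n⇒∃[o]m+o≡n j≤y₀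
    ... | γ , v₁+γ≡j | γ′ , j+γ′≡y₀ =
      bounded-if-chord-A-C c 2≤K α t₁ γ γ′ e (sym α+t₁≡la) (+-cancelˡ-≡ (lu + la + lx + lb + lv) _ _ lc≡)
        (hop-cast refl (cong at (sym v₁+γ≡j)) hop)
      where
        open ≡-Reasoning
        lc≡ : lu + la + lx + lb + lv + lc ≡ lu + la + lx + lb + lv + (γ + γ′)
        lc≡ = begin
          lu + la + lx + lb + lv + lc         ≡⟨ sym j+γ′≡y₀ ⟩
          lu + α + suc e + δ + γ′             ≡⟨ cong (_+ γ′) (sym v₁+γ≡j) ⟩
          lu + la + lx + lb + lv + γ + γ′     ≡⟨ +-assoc (lu + la + lx + lb + lv) γ γ′ ⟩
          lu + la + lx + lb + lv + (γ + γ′)   ∎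

  module _ {lu la lx lb lv lc ly ld : ℕ} (c : Quadrangle lu la lx lb lv lc ly ld) (IH : ShorterBounded (Quadrangle.L c)) where
    open Quadrangle c hiding (Bounded)

    -- Rotating the quadrangle one corner forward turns a chord starting on B, C, D into one
    -- starting on A, B, C.
    bounded-if-chord-from-B : ∀ α j e → Hop e (at (lu + la + lx + α)) (at j) → α ≤ lb →
      lu + la + lx + α + suc e ≤ j → j ≤ L → Bounded c
    bounded-if-chord-from-B α j e hop α≤lb gap j≤L =
      bounded-rotation c (bounded-if-chord-from-A-to-ABC (rotation c) IH α R.j e R.hop α≤lb R.gap R.j≤rest)
      where
        i≡ : lu + la + (lx + α) ≡ lu + la + lx + α
        i≡ = solve (lu ∷ la ∷ lx ∷ α ∷ [])
        module R = ChordOfRotation (chord-in-rotation c (lx + α) i≡ hop gap j≤L)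

  module _ {lu la lx lb lv lc ly ld : ℕ} (c : Quadrangle lu la lx lb lv lc ly ld) (IH : ShorterBounded (Quadrangle.L c)) where
    open Quadrangle c hiding (Bounded)

    bounded-if-chord-from-C : ∀ α j e → Hop e (at (lu + la + lx + lb + lv + α)) (at j) → α ≤ lc →
      lu + la + lx + lb + lv + α + suc e ≤ j → j ≤ L → Bounded c
    bounded-if-chord-from-C α j e hop α≤lc gap j≤L =
      bounded-rotation c (bounded-if-chord-from-B (rotation c) IH α R.j e R.hop α≤lc R.gap (≤-trans R.j≤rest (rest≤L c)))
      where
        i≡ : lu + la + (lx + lb + lv + α) ≡ lu + la + lx + lb + lv + α
        i≡ = solve (lu ∷ la ∷ lx ∷ lb ∷ lv ∷ α ∷ [])
        module R = ChordOfRotation (chord-in-rotation c (lx + lb + lv + α) i≡ hop gap j≤L)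

  module _ {lu la lx lb lv lc ly ld : ℕ} (c : Quadrangle lu la lx lb lv lc ly ld) (IH : ShorterBounded (Quadrangle.L c)) where
    open Quadrangle c hiding (Bounded)

    bounded-if-chord-from-D : ∀ α j e → Hop e (at (lu + la + lx + lb + lv + lc + ly + α)) (at j) →
      lu + la + lx + lb + lv + lc + ly + α + suc e ≤ j → j ≤ L → Bounded c
    bounded-if-chord-from-D α j e hop gap j≤L =
      bounded-rotation c (bounded-if-chord-from-C (rotation c) IH α R.j e R.hop α≤ld R.gap (≤-trans R.j≤rest (rest≤L c)))
      where
        i≡ : lu + la + (lx + lb + lv + lc + ly + α) ≡ lu + la + lx + lb + lv + lc + ly + α
        i≡ = solve (lu ∷ la ∷ lx ∷ lb ∷ lv ∷ lc ∷ ly ∷ α ∷ [])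
        module R = ChordOfRotation (chord-in-rotation c (lx + lb + lv + lc + ly + α) i≡ hop gap j≤L)
        α≤ld : α ≤ ld
        α≤ld = +-cancelˡ-≤ (lu + la + lx + lb + lv + lc + ly) _ _
                 (≤-trans (m≤m+n _ (suc e)) (≤-trans gap (≤-trans j≤L (≤-reflexive length))))

  module _ {lu la lx lb lv lc ly ld : ℕ} (c : Quadrangle lu la lx lb lv lc ly ld) (IH : ShorterBounded (Quadrangle.L c)) where
    open Quadrangle c hiding (Bounded)

    -- A chord reaching past C is read backwards, from side D of the rotated quadrangle.
    bounded-if-chord-from-A : ∀ α j e → Hop e (at (lu + α)) (at j) → α ≤ la → lu + α + suc e ≤ j →
      j + suc e ≤ L + (lu + α) → j ≤ L → Bounded c
    bounded-if-chord-from-A α j e hop α≤la gap gap-around j≤L with j ≤? lu + la + lx + lb + lv + lc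
    ... | yes j≤y₀ = bounded-if-chord-from-A-to-ABC c IH α j e hop α≤la gap j≤y₀
    ... | no j≰y₀ with m≤n⇒∃[o]m+o≡n (≤-trans (p+l≤1+p (lu + la + lx + lb + lv + lc) ly≤1) (≰⇒> j≰y₀))
    ...   | α′ , refl = bounded-rotation c
            (bounded-if-chord-from-C (rotation c) IH α′ (rest + (lu + α)) e hop′ α′≤ld gap′ end≤L)
      where
        open ≤-Reasoning
        rest : ℕ
        rest = lx + lb + lv + lc + ly + ld
        α′≤ld : α′ ≤ ld
        α′≤ld = +-cancelˡ-≤ (lu + la + lx + lb + lv + lc + ly) _ _ (≤-trans j≤L (≤-reflexive length))
        j≡ : lu + la + (lx + lb + lv + lc + ly + α′) ≡ lu + la + lx + lb + lv + lc + ly + α′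
        j≡ = solve (lu ∷ la ∷ lx ∷ lb ∷ lv ∷ lc ∷ ly ∷ α′ ∷ [])
        hop′ : Hop e (Quadrangle.at (rotation c) (lx + lb + lv + lc + ly + α′)) (Quadrangle.at (rotation c) (rest + (lu + α)))
        hop′ = hop-cast (sym (rotated c _ (+-monoʳ-≤ (lx + lb + lv + lc + ly) α′≤ld) j≡)) (sym (wrapped c (lu + α))) (hop-sym hop)
        gap-around′ : lu + la + (lx + lb + lv + lc + ly + α′ + suc e) ≤ lu + la + (rest + (lu + α))
        gap-around′ = begin
          lu + la + (lx + lb + lv + lc + ly + α′ + suc e) ≡⟨ solve (lu ∷ la ∷ lx ∷ lb ∷ lv ∷ lc ∷ ly ∷ α′ ∷ e ∷ []) ⟩
          lu + la + lx + lb + lv + lc + ly + α′ + suc e   ≤⟨ gap-around ⟩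
          L + (lu + α)                                     ≡⟨ cong (_+ (lu + α)) (L≡x₀+rest c) ⟩
          lu + la + rest + (lu + α)                        ≡⟨ +-assoc (lu + la) rest (lu + α) ⟩
          lu + la + (rest + (lu + α))                      ∎
        gap′ : lx + lb + lv + lc + ly + α′ + suc e ≤ rest + (lu + α)
        gap′ = +-cancelˡ-≤ (lu + la) _ _ gap-around′
        end≤L : rest + (lu + α) ≤ L
        end≤L = begin
          rest + (lu + α)   ≤⟨ +-monoʳ-≤ rest (+-monoʳ-≤ lu α≤la) ⟩
          rest + (lu + la)  ≡⟨ +-comm rest (lu + la) ⟩
          lu + la + rest    ≡⟨ L≡x₀+rest c ⟨
          L                 ∎

  module _ {lu la lx lb lv lc ly ld : ℕ} (c : Quadrangle lu la lx lb lv lc ly ld) (IH : ShorterBounded (Quadrangle.L c)) where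
    open Quadrangle c hiding (Bounded)

    bounded-if-chord-from : ∀ i j e → Hop e (at i) (at j) → i + suc e ≤ j → j + suc e ≤ L + i → j ≤ L → lu ≤ i → Bounded c
    bounded-if-chord-from i j e hop gap gap-around j≤L lu≤i with i ≤? lu + la | i ≤? lu + la + lx + lb | i ≤? lu + la + lx + lb + lv + lc
    ... | yes i≤x₀ | _ | _ with m≤n⇒∃[o]m+o≡n lu≤i
    ...   | α , refl = bounded-if-chord-from-A c IH α j e hop (+-cancelˡ-≤ lu _ _ i≤x₀) gap gap-around j≤L
    bounded-if-chord-from i j e hop gap gap-around j≤L lu≤i | no i≰x₀ | yes i≤v₀ | _
      with m≤n⇒∃[o]m+o≡n (≤-trans (p+l≤1+p (lu + la) lx≤1) (≰⇒> i≰x₀))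
    ... | α , refl = bounded-if-chord-from-B c IH α j e hop (+-cancelˡ-≤ (lu + la + lx) _ _ i≤v₀) gap j≤L
    bounded-if-chord-from i j e hop gap gap-around j≤L lu≤i | no _ | no i≰v₀ | yes i≤y₀
      with m≤n⇒∃[o]m+o≡n (≤-trans (p+l≤1+p (lu + la + lx + lb) lv≤1) (≰⇒> i≰v₀))
    ... | α , refl = bounded-if-chord-from-C c IH α j e hop (+-cancelˡ-≤ (lu + la + lx + lb + lv) _ _ i≤y₀) gap j≤L
    bounded-if-chord-from i j e hop gap gap-around j≤L lu≤i | no _ | no _ | no i≰y₀
      with m≤n⇒∃[o]m+o≡n (≤-trans (p+l≤1+p (lu + la + lx + lb + lv + lc) ly≤1) (≰⇒> i≰y₀))
    ... | α , refl = bounded-if-chord-from-D c IH α j e hop gap j≤L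

    -- A chord starting inside the corner U (i < lu ≤ 1) starts at position 0, which is also
    -- position L, so it can be read backwards from j.
    bounded-if-chord : Chord walk → Bounded c
    bounded-if-chord record { i = i ; j = j ; e = e ; hop = hop ; gap = gap ; gap-around = gap-around ; j≤L = j≤L } with lu ≤? i
    ... | yes lu≤i = bounded-if-chord-from i j e hop gap gap-around j≤L lu≤i
    ... | no lu≰i with i
    ...   | suc _ = ⊥-elim (lu≰i (≤-trans lu≤1 (s≤s z≤n)))
    ...   | zero = bounded-if-chord-from j L e (hop-cast refl (sym closed) (hop-sym hop))
                     (≤-trans gap-around (≤-reflexive (+-identityʳ L))) (+-monoʳ-≤ L gap) ≤-refl
                     (≤-trans lu≤1 (≤-trans (s≤s z≤n) gap))

module ChordalQuadrangles {a b : Level} (G : Graph a b) (K : ℕ) (2≤K : 2 ≤ K) (chordal : Chordal G (suc (K + K))) where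
  open Graph G renaming (sym to E-sym)
  open WalkCalculus G
  open Quadrangles G K
  open ChordCases G K 2≤K

  -- Either some chord shortens the quadrangle, or its closed walk is an induced cycle, hence short.
  bounded-if-shorter-bounded : ∀ {lu la lx lb lv lc ly ld} (c : Quadrangle lu la lx lb lv lc ly ld) →
    ShorterBounded (Quadrangle.L c) → Bounded c
  bounded-if-shorter-bounded {la = la} {lb = lb} {lc = lc} {ld = ld} c IH n m U↔V X↔Y with Quadrangle.L c ≤? suc (K + K)
  ... | yes short = short⇒bounded c short n m U↔V X↔Y
  ... | no long with n + m ≤? (la + lc) ⊔ (lb + ld) + K
  ...   | yes bounded = bounded
  ...   | no unbounded = ⊥-elim (chordal (Quadrangle.L c) (≰⇒> long) (chordless⇒induced (Quadrangle.walk c) 3≤L chordless))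
    where
      3≤L : 3 ≤ Quadrangle.L c
      3≤L = ≤-trans (s≤s (s≤s (≤-trans (≤-trans (s≤s z≤n) 2≤K) (m≤m+n K K)))) (≰⇒> long)
      chordless : ¬ Chord (Quadrangle.walk c)
      chordless chord = unbounded (bounded-if-chord c IH chord n m U↔V X↔Y)

  shorter-bounded : ∀ n → ShorterBounded n
  shorter-bounded zero c ()
  shorter-bounded (suc n) c L<1+n =
    bounded-if-shorter-bounded c (λ c′ L′<L → shorter-bounded n c′ (<-≤-trans L′<L (≤-pred L<1+n)))

  diagonals-bounded : ∀ {u x v y a′ b′ c′ d′ d₁ d₂} → Walk G u x a′ → Walk G x v b′ → Walk G v y c′ → Walk G y u d′ →
    (∀ m → Walk G u v m → d₁ ≤ m) → (∀ m → Walk G x y m → d₂ ≤ m) → d₁ + d₂ ≤ (a′ + c′) ⊔ (b′ + d′) + K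
  diagonals-bounded {u} {x} {v} {y} {a′} {b′} {c′} {d′} {d₁} {d₂} u→x x→v v→y y→u u↔v x↔y =
    shorter-bounded (suc (a′ + b′ + c′ + d′)) quadrangle ≤-refl d₁ d₂
      (λ p q w → u↔v _ (castʷ (trans (corner₀ p) at-u) (trans (corner₀ q) at-v) w))
      (λ p q w → x↔y _ (castʷ (trans (corner₀ p) at-x) (trans (corner₀ q) at-y) w))
    where
      cycle : Walk G u u (a′ + b′ + c′ + d′)
      cycle = u→x ++ʷ x→v ++ʷ v→y ++ʷ y→u
      quadrangle : Quadrangle 0 a′ 0 b′ 0 c′ 0 d′
      quadrangle = record
        { L = a′ + b′ + c′ + d′ ; walk = closedWalk cycle ; length = solve (a′ ∷ b′ ∷ c′ ∷ d′ ∷ [])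
        ; lu≤1 = z≤n ; lx≤1 = z≤n ; lv≤1 = z≤n ; ly≤1 = z≤n }
      at-u : vertexAt cycle 0 ≡ u
      at-u = vertexAt-start cycle
      at-x : vertexAt cycle a′ ≡ x
      at-x = begin
        vertexAt cycle a′                             ≡⟨ vertexAt-++ʷ (u→x ++ʷ x→v ++ʷ v→y) y→u (≤-trans (m≤m+n a′ b′) (m≤m+n _ c′)) ⟩
        vertexAt (u→x ++ʷ x→v ++ʷ v→y) a′             ≡⟨ vertexAt-++ʷ (u→x ++ʷ x→v) v→y (m≤m+n a′ b′) ⟩
        vertexAt (u→x ++ʷ x→v) a′                     ≡⟨ vertexAt-++ʷ u→x x→v ≤-refl ⟩
        vertexAt u→x a′                               ≡⟨ vertexAt-end u→x ⟩
        x                                             ∎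
        where open ≡-Reasoning
      at-v : vertexAt cycle (a′ + 0 + b′) ≡ v
      at-v = begin
        vertexAt cycle (a′ + 0 + b′)                  ≡⟨ cong (λ k → vertexAt cycle (k + b′)) (+-identityʳ a′) ⟩
        vertexAt cycle (a′ + b′)                      ≡⟨ vertexAt-++ʷ (u→x ++ʷ x→v ++ʷ v→y) y→u (m≤m+n _ c′) ⟩
        vertexAt (u→x ++ʷ x→v ++ʷ v→y) (a′ + b′)      ≡⟨ vertexAt-++ʷ (u→x ++ʷ x→v) v→y ≤-refl ⟩
        vertexAt (u→x ++ʷ x→v) (a′ + b′)              ≡⟨ vertexAt-end (u→x ++ʷ x→v) ⟩
        v                                             ∎
        where open ≡-Reasoning
      at-y : vertexAt cycle (a′ + 0 + b′ + 0 + c′) ≡ y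
      at-y = begin
        vertexAt cycle (a′ + 0 + b′ + 0 + c′)         ≡⟨ cong (vertexAt cycle) (solve (a′ ∷ b′ ∷ c′ ∷ [])) ⟩
        vertexAt cycle (a′ + b′ + c′)                 ≡⟨ vertexAt-++ʷ (u→x ++ʷ x→v ++ʷ v→y) y→u ≤-refl ⟩
        vertexAt (u→x ++ʷ x→v ++ʷ v→y) (a′ + b′ + c′) ≡⟨ vertexAt-end (u→x ++ʷ x→v ++ʷ v→y) ⟩
        y                                             ∎
        where open ≡-Reasoning

module _ where
  open import Data.Integer using (+_)

  toℚᵘ-half : ∀ n → toℚᵘ (half n) ℚᵘ.≃ mkℚᵘ (+ n) 1
  toℚᵘ-half n = ℚ.toℚᵘ-fromℚᵘ (mkℚᵘ (+ n) 1)

  half-mono-≤ : ∀ {m n} → m ≤ n → half m ℚ.≤ half n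
  half-mono-≤ {m} {n} m≤n = ℚ.toℚᵘ-cancel-≤
    (ℚᵘ.≤-respˡ-≃ (ℚᵘ.≃-sym (toℚᵘ-half m)) (ℚᵘ.≤-respʳ-≃ (ℚᵘ.≃-sym (toℚᵘ-half n))
      (*≤* (subst₂ ℤ._≤_ (ℤ.pos-* m 2) (ℤ.pos-* n 2) (+≤+ (*-monoˡ-≤ 2 m≤n))))))

  half-+ : ∀ m n → half m ℚ.+ half n ≡ half (m + n)
  half-+ m n = ℚ.toℚᵘ-injective (ℚᵘ.≃-trans (ℚ.toℚᵘ-homo-+ (half m) (half n))
    (ℚᵘ.≃-trans (ℚᵘ.+-cong (toℚᵘ-half m) (toℚᵘ-half n)) (ℚᵘ.≃-trans (*≡* cross) (ℚᵘ.≃-sym (toℚᵘ-half (m + n))))))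
    where
      open ≡-Reasoning
      cross : (+ m ℤ.* + 2 ℤ.+ + n ℤ.* + 2) ℤ.* + 2 ≡ + (m + n) ℤ.* + 4
      cross = begin
        (+ m ℤ.* + 2 ℤ.+ + n ℤ.* + 2) ℤ.* + 2 ≡⟨ cong₂ (λ p q → (p ℤ.+ q) ℤ.* + 2) (ℤ.pos-* m 2) (ℤ.pos-* n 2) ⟨
        (+ (m * 2) ℤ.+ + (n * 2)) ℤ.* + 2     ≡⟨ cong (ℤ._* + 2) (ℤ.pos-+ (m * 2) (n * 2)) ⟨
        + (m * 2 + n * 2) ℤ.* + 2             ≡⟨ ℤ.pos-* (m * 2 + n * 2) 2 ⟨
        + ((m * 2 + n * 2) * 2)               ≡⟨ cong +_ (solve (m ∷ n ∷ [])) ⟩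
        + ((m + n) * 4)                       ≡⟨ ℤ.pos-* (m + n) 4 ⟩
        + (m + n) ℤ.* + 4                     ∎

  half-⊔ : ∀ m n → half m ℚ.⊔ half n ≡ half (m ⊔ n)
  half-⊔ m n with ≤-total m n
  ... | inj₁ m≤n = trans (ℚ.p≤q⇒p⊔q≡q (half-mono-≤ m≤n)) (cong half (sym (m≤n⇒m⊔n≡n m≤n)))
  ... | inj₂ n≤m = trans (ℚ.p≥q⇒p⊔q≡p (half-mono-≤ n≤m)) (cong half (sym (m≥n⇒m⊔n≡m n≤m)))

  half-⊓ : ∀ m n → half m ℚ.⊓ half n ≡ half (m ⊓ n)
  half-⊓ m n with ≤-total m n
  ... | inj₁ m≤n = trans (ℚ.p≤q⇒p⊓q≡p (half-mono-≤ m≤n)) (cong half (sym (m≤n⇒m⊓n≡m m≤n)))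
  ... | inj₂ n≤m = trans (ℚ.p≥q⇒p⊓q≡q (half-mono-≤ n≤m)) (cong half (sym (m≥n⇒m⊓n≡n n≤m)))

median : ℕ → ℕ → ℕ → ℕ
median p q r = (p ⊓ q) ⊔ (q ⊓ r) ⊔ (p ⊓ r)

≤-median+ : ∀ {x y z M} K → x ⊓ y ≤ M → x ⊓ z ≤ M → x ≤ y ⊔ z + K → x ≤ M + K
≤-median+ {x} {y} {z} {M} K x⊓y≤M x⊓z≤M x≤y⊔z+K with ≤-total x y | ≤-total x z
... | inj₁ x≤y | _ = ≤-trans (≤-trans (≤-reflexive (sym (m≤n⇒m⊓n≡m x≤y))) x⊓y≤M) (m≤m+n M K)
... | inj₂ _ | inj₁ x≤z = ≤-trans (≤-trans (≤-reflexive (sym (m≤n⇒m⊓n≡m x≤z))) x⊓z≤M) (m≤m+n M K)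
... | inj₂ y≤x | inj₂ z≤x = ≤-trans x≤y⊔z+K (+-monoˡ-≤ K (⊔-lub (≤-trans (≤-reflexive (sym (m≥n⇒m⊓n≡n y≤x))) x⊓y≤M)
                                                                  (≤-trans (≤-reflexive (sym (m≥n⇒m⊓n≡n z≤x))) x⊓z≤M)))

max≤median+ : ∀ p q r K → p ≤ q ⊔ r + K → q ≤ p ⊔ r + K → r ≤ p ⊔ q + K → p ⊔ q ⊔ r ≤ median p q r + K
max≤median+ p q r K p≤ q≤ r≤ = ⊔-lub (⊔-lub
    (≤-median+ K p⊓q≤M p⊓r≤M p≤)
    (≤-median+ K (≤-trans (≤-reflexive (⊓-comm q p)) p⊓q≤M) q⊓r≤M q≤))
    (≤-median+ K (≤-trans (≤-reflexive (⊓-comm r p)) p⊓r≤M) (≤-trans (≤-reflexive (⊓-comm r q)) q⊓r≤M) r≤)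
  where
    p⊓q≤M : p ⊓ q ≤ median p q r
    p⊓q≤M = ≤-trans (m≤m⊔n (p ⊓ q) (q ⊓ r)) (m≤m⊔n _ (p ⊓ r))
    q⊓r≤M : q ⊓ r ≤ median p q r
    q⊓r≤M = ≤-trans (m≤n⊔m (p ⊓ q) (q ⊓ r)) (m≤m⊔n _ (p ⊓ r))
    p⊓r≤M : p ⊓ r ≤ median p q r
    p⊓r≤M = m≤n⊔m _ (p ⊓ r)

p≤q+r⇒p-q≤r : ∀ {p q r} → p ℚ.≤ q ℚ.+ r → p ℚ.- q ℚ.≤ r
p≤q+r⇒p-q≤r {p} {q} {r} p≤q+r = begin
  p ℚ.- q           ≤⟨ ℚ.+-monoˡ-≤ (ℚ.- q) p≤q+r ⟩
  q ℚ.+ r ℚ.- q     ≡⟨ cong (ℚ._- q) (ℚ.+-comm q r) ⟩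
  r ℚ.+ q ℚ.- q     ≡⟨ ℚ.+-assoc r q (ℚ.- q) ⟩
  r ℚ.+ (q ℚ.- q)   ≡⟨ cong (r ℚ.+_) (ℚ.+-inverseʳ q) ⟩
  r ℚ.+ 0ℚ          ≡⟨ ℚ.+-identityʳ r ⟩
  r                 ∎
  where
    open ℚ.≤-Reasoning

max3-med3-half-≤ : ∀ p q r K → p ≤ q ⊔ r + K → q ≤ p ⊔ r + K → r ≤ p ⊔ q + K →
  max3 (half p) (half q) (half r) ℚ.- med3 (half p) (half q) (half r) ℚ.≤ half K
max3-med3-half-≤ p q r K p≤ q≤ r≤ = p≤q+r⇒p-q≤r (begin
  max3 (half p) (half q) (half r)             ≡⟨ trans (cong (ℚ._⊔ half r) (half-⊔ p q)) (half-⊔ (p ⊔ q) r) ⟩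
  half (p ⊔ q ⊔ r)                            ≤⟨ half-mono-≤ (max≤median+ p q r K p≤ q≤ r≤) ⟩
  half (median p q r + K)                     ≡⟨ half-+ (median p q r) K ⟨
  half (median p q r) ℚ.+ half K              ≡⟨ cong (ℚ._+ half K) med3-half ⟨
  med3 (half p) (half q) (half r) ℚ.+ half K  ∎)
  where
    open ℚ.≤-Reasoning
    med3-half : med3 (half p) (half q) (half r) ≡ half (median p q r)
    med3-half = begin-equality
      (half p ℚ.⊓ half q) ℚ.⊔ (half q ℚ.⊓ half r) ℚ.⊔ (half p ℚ.⊓ half r)
        ≡⟨ cong₂ (λ s t → s ℚ.⊔ t ℚ.⊔ (half p ℚ.⊓ half r)) (half-⊓ p q) (half-⊓ q r) ⟩
      half (p ⊓ q) ℚ.⊔ half (q ⊓ r) ℚ.⊔ (half p ℚ.⊓ half r)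
        ≡⟨ cong₂ ℚ._⊔_ (half-⊔ (p ⊓ q) (q ⊓ r)) (half-⊓ p r) ⟩
      half ((p ⊓ q) ⊔ (q ⊓ r)) ℚ.⊔ half (p ⊓ r)
        ≡⟨ half-⊔ ((p ⊓ q) ⊔ (q ⊓ r)) (p ⊓ r) ⟩
      half (median p q r) ∎

Chordal-mono : ∀ {a b} {G : Graph a b} {k k′} → k ≤ k′ → Chordal G k → Chordal G k′
Chordal-mono k≤k′ chordal m k′<m = chordal m (≤-<-trans k≤k′ k′<m)

n≤1+⌊n/2⌋+⌊n/2⌋ : ∀ n → n ≤ suc (⌊ n /2⌋ + ⌊ n /2⌋)
n≤1+⌊n/2⌋+⌊n/2⌋ zero = z≤n
n≤1+⌊n/2⌋+⌊n/2⌋ (suc zero) = s≤s z≤n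
n≤1+⌊n/2⌋+⌊n/2⌋ (suc (suc n)) = s≤s (≤-trans (s≤s (n≤1+⌊n/2⌋+⌊n/2⌋ n)) (≤-reflexive (cong suc (sym (+-suc ⌊ n /2⌋ ⌊ n /2⌋)))))

theorem2p1 : ∀ {a b : Level} (k : ℕ) → 4 ≤ k → (G : Graph a b) →
    Connected G → Chordal G k → Hyperbolic G (half ⌊ k /2⌋)
theorem2p1 k 4≤k G _ chordal x y u v uv xy ux vy uy vx (u→v , u↔v) (x→y , x↔y) (u→x , u↔x) (v→y , v↔y) (u→y , u↔y) (v→x , v↔x) =
  max3-med3-half-≤ (uv + xy) (ux + vy) (uy + vx) K
    (subst (λ s → uv + xy ≤ (ux + vy) ⊔ s + K) (+-comm vx uy)
      (diagonals-bounded u→x (reverseʷ v→x) v→y (reverseʷ u→y) u↔v x↔y))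
    (subst (λ s → ux + vy ≤ (uv + xy) ⊔ s + K) (+-comm vx uy)
      (diagonals-bounded u→v v→x x→y (reverseʷ u→y) u↔x v↔y))
    (subst (λ s → uy + vx ≤ s + K) (trans (cong ((ux + vy) ⊔_) (+-comm xy uv)) (⊔-comm (ux + vy) (uv + xy)))
      (diagonals-bounded u→x x→y (reverseʷ v→y) (reverseʷ u→v) u↔y (λ m w → v↔x m (reverseʷ w))))
  where
    K : ℕ
    K = ⌊ k /2⌋
    open WalkCalculus G using (reverseʷ)
    open ChordalQuadrangles G K (⌊n/2⌋-mono 4≤k) (Chordal-mono {G = G} (n≤1+⌊n/2⌋+⌊n/2⌋ k) chordal)
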